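{- For any $d$-regular connected graph $G$, both maps $f^t f : K(\operatorname{line} G) \rightarrow K(\operatorname{line} G)$ and $f f^t : K(\operatorname{sd} G) \rightarrow K(\operatorname{sd} G)$ are scalar multiplications by $d$.
   Context: $G$ is simple; $\operatorname{line} G$ is its line graph (vertices $uv$ for edges $\{u,v\}$ of $G$), $\operatorname{sd} G$ its edge subdivision (new midpoint vertex $uv$ on each edge), and $K(\cdot)$ denotes the critical group. $f:{\mathbb R}^{E_{\operatorname{line} G}}\to{\mathbb R}^{E_{\operatorname{sd} G}}$ is the linear map with $f(uv,vw)=(uv,v)+(v,vw)$, whose adjoint is $f^t(uv,v)=\sum_{w:\{v,w\}\in E}(uv,vw)$; both are morphisms of rational orthogonal decompositions and so induce maps on critical groups. -}

module Defs where

open import Data.Nat using (ℕ)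
open import Data.Bool using (Bool; true; false; T; _∧_; if_then_else_)
open import Data.Fin using (Fin; _<?_; _≟_)
open import Data.Fin.Properties using () renaming (_≟_ to _≟F_)
open import Data.Integer using (ℤ; 0ℤ; 1ℤ; _+_; _-_; _*_; +_)
open import Data.Rational using (ℚ) renaming (_-_ to _-ℚ_; _/_ to _/ℚ_)
open import Data.List using (List; []; _∷_; foldr; concatMap; length; filter)
open import Data.List using () renaming (allFin to allFinL)
open import Data.Product using (Σ; Σ-syntax; ∃; ∃-syntax; _×_; _,_; proj₁; proj₂)
open import Data.Sum using (_⊎_; inj₁; inj₂)
import Data.Product.Properties as PP
import Data.Sum.Properties as SP
open import Relation.Binary.PropositionalEquality using (_≡_)
open import Relation.Binary.Definitions using (DecidableEquality)
open import Relation.Nullary.Decidable using (⌊_⌋; yes; no)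
open import Data.Bool.Properties using (T?)

record SimpleGraph (n : ℕ) : Set where
  field
    adj      : Fin n → Fin n → Bool
    adj-sym  : ∀ u v → adj u v ≡ adj v u
    adj-irr  : ∀ u → adj u u ≡ false
open SimpleGraph public

vertices : (n : ℕ) → List (Fin n)
vertices n = allFinL n

degree : ∀ {n} → SimpleGraph n → Fin n → ℕ
degree {n} G v = length (filter (λ w → T? (adj G v w)) (vertices n))

Regular : ∀ {n} → SimpleGraph n → ℕ → Set
Regular G d = ∀ v → degree G v ≡ d

data Reachable {n} (G : SimpleGraph n) : Fin n → Fin n → Set where
  here : ∀ {u} → Reachable G u u
  step : ∀ {u v w} → T (adj G u v) → Reachable G v w → Reachable G u w

Connected : ∀ {n} → SimpleGraph n → Set
Connected G = ∀ u v → Reachable G u v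

-- Oriented finite graphs, 1-chains, and the critical group
-- K(H) = Λ / (Λ ∩ Cut ⊕ Λ ∩ Flow), Λ = ℤ^E (cut/flow space of the
-- rational orthogonal decomposition of ℝ^E).

record OrGraph : Set₁ where
  field
    Vtx    : Set
    _≟V_   : DecidableEquality Vtx
    Edge   : Set
    edges  : List Edge          -- every edge exactly once
    src    : Edge → Vtx
    tgt    : Edge → Vtx
open OrGraph public

sumL : ∀ {A : Set} → List A → (A → ℤ) → ℤ
sumL xs f = foldr (λ a s → f a + s) 0ℤ xs

Chain : OrGraph → Set
Chain H = Edge H → ℤ

ind : Bool → ℤ
ind true  = 1ℤ
ind false = 0ℤ

boundary : (H : OrGraph) → Chain H → Vtx H → ℤ
boundary H x v =
  sumL (edges H) (λ e → x e * (ind ⌊ (_≟V_ H) (tgt H e) v ⌋ - ind ⌊ (_≟V_ H) (src H e) v ⌋))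

IsFlow : (H : OrGraph) → Chain H → Set
IsFlow H x = ∀ v → boundary H x v ≡ 0ℤ

IsCut : (H : OrGraph) → Chain H → Set
IsCut H x = Σ[ p ∈ (Vtx H → ℚ) ] (∀ e → (x e /ℚ 1) ≡ (p (tgt H e) -ℚ p (src H e)))

CritEq : (H : OrGraph) → Chain H → Chain H → Set
CritEq H x y = Σ[ c ∈ Chain H ] Σ[ φ ∈ Chain H ]
  (IsCut H c × IsFlow H φ × (∀ e → x e - y e ≡ c e + φ e))

scale : ∀ {H} → ℕ → Chain H → Chain H
scale d x e = + d * x e

linMap : (H₁ H₂ : OrGraph) → (Edge H₁ → Edge H₂ → ℤ) → Chain H₁ → Chain H₂
linMap H₁ H₂ M x e₂ = sumL (edges H₁) (λ e₁ → x e₁ * M e₁ e₂)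

linMapᵗ : (H₁ H₂ : OrGraph) → (Edge H₁ → Edge H₂ → ℤ) → Chain H₂ → Chain H₁
linMapᵗ H₁ H₂ M z e₁ = sumL (edges H₂) (λ e₂ → M e₁ e₂ * z e₂)

collect : ∀ {A : Set} (P : A → Bool) → List A → List (Σ A (λ a → T (P a)))
collect P [] = []
collect P (a ∷ as) with T? (P a)
... | yes p = (a , p) ∷ collect P as
... | no _  = collect P as

pairs : (n : ℕ) → List (Fin n × Fin n)
pairs n = concatMap (λ u → Data.List.map (λ v → (u , v)) (allFinL n)) (allFinL n)

triples : (n : ℕ) → List (Fin n × Fin n × Fin n)
triples n = concatMap (λ u → Data.List.map (λ vw → (u , vw)) (pairs n)) (allFinL n)

_<ᵇ_ : ∀ {n} → Fin n → Fin n → Bool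
u <ᵇ v = ⌊ u <? v ⌋

_==_ : ∀ {n} → Fin n → Fin n → Bool
u == v = ⌊ u ≟F v ⌋

-- the vertex uv = {u,v} of line G (resp. midpoint of sd G), stored as a sorted pair
edgeV : ∀ {n} → Fin n → Fin n → Fin n × Fin n
edgeV u v = if u <ᵇ v then (u , v) else (v , u)

decPair : ∀ {n} → DecidableEquality (Fin n × Fin n)
decPair = PP.≡-dec _≟F_ _≟F_

-- line G: vertices are (sorted) pairs {u,v} (those that are edges of G;
-- other pairs are isolated vertices and never occur in an edge).
-- Edges {uv, vw} (u ≠ w) are listed once, as triples (u,v,w) with u < w,
-- oriented from uv to vw.
isLineEdge : ∀ {n} → SimpleGraph n → Fin n × Fin n × Fin n → Bool
isLineEdge G (u , v , w) = adj G u v ∧ adj G v w ∧ (u <ᵇ w)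

LineEdge : ∀ {n} → SimpleGraph n → Set
LineEdge {n} G = Σ (Fin n × Fin n × Fin n) (λ t → T (isLineEdge G t))

lineG : ∀ {n} → SimpleGraph n → OrGraph
lineG {n} G = record
  { Vtx   = Fin n × Fin n
  ; _≟V_  = decPair
  ; Edge  = LineEdge G
  ; edges = collect (isLineEdge G) (triples n)
  ; src   = λ { ((u , v , w) , _) → edgeV u v }
  ; tgt   = λ { ((u , v , w) , _) → edgeV v w }
  }

-- sd G: vertices are the vertices of G (inj₁) and the midpoints uv (inj₂).
-- Edges (uv, v) are indexed by ordered pairs (u,v) with u ~ v, oriented from uv to v.
SdEdge : ∀ {n} → SimpleGraph n → Set
SdEdge {n} G = Σ (Fin n × Fin n) (λ p → T (adj G (proj₁ p) (proj₂ p)))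

sdG : ∀ {n} → SimpleGraph n → OrGraph
sdG {n} G = record
  { Vtx   = Fin n ⊎ (Fin n × Fin n)
  ; _≟V_  = SP.≡-dec _≟F_ decPair
  ; Edge  = SdEdge G
  ; edges = collect (λ p → adj G (proj₁ p) (proj₂ p)) (pairs n)
  ; src   = λ { ((u , v) , _) → inj₂ (edgeV u v) }
  ; tgt   = λ { ((u , v) , _) → inj₁ v }
  }

-- f(uv,vw) = (uv,v) + (v,vw) = (uv,v) - (vw,v): coefficient matrix
fMatrix : ∀ {n} (G : SimpleGraph n) → LineEdge G → SdEdge G → ℤ
fMatrix G ((u , v , w) , _) ((a , b) , _) =
  ind ((u == a) ∧ (v == b)) - ind ((w == a) ∧ (v == b))

f : ∀ {n} (G : SimpleGraph n) → Chain (lineG G) → Chain (sdG G)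
f G = linMap (lineG G) (sdG G) (fMatrix G)

fᵗ : ∀ {n} (G : SimpleGraph n) → Chain (sdG G) → Chain (lineG G)
fᵗ G = linMapᵗ (lineG G) (sdG G) (fMatrix G)

-- Boundaries in line G are inner products with the incidence vectors ι_t of its vertices
-- t, and fᵗ f is self-adjoint, so fᵗ f x − d x is a flow as soon as fᵗ f ι_t = d ι_t.
-- Both this and the statement for sd G come from one computation: if a line chain is the
-- coboundary (u,v,w) ↦ ψ v w − ψ v u, then f sends it to ∑_{c ~ b} ψ b c − d ψ b a on the
-- sd edge (ab, b), since exactly the d − 1 line edges between ab and the bc with c ≠ a
-- contribute. Applied to ι_t this gives fᵗ f ι_t = d ι_t; applied to fᵗ z it shows that
-- f fᵗ z − d z depends only on the original vertex b of each sd edge (ab, b), i.e. it is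
-- the coboundary of a potential vanishing at the midpoints, hence a cut.

module Submission where

open import Defs
open import Data.Nat using (ℕ; zero; suc)
open import Data.Bool using (Bool; true; false; T; _∧_)
open import Data.Bool.Properties using (T?; T-irrelevant; T-∧)
open import Data.Fin using (Fin; zero; suc; _<_; _<?_)
open import Data.Fin.Properties using (<-cmp; <-asym; suc-injective) renaming (_≟_ to _≟F_)
open import Data.Integer using (ℤ; 0ℤ; 1ℤ; _+_; _-_; _*_; -_; +_)
import Data.Integer.Properties as ℤP
open import Data.Integer.Tactic.RingSolver using (solve-∀)
open import Data.List using (List; []; _∷_; _++_; concatMap; map; tabulate; length; lookup; filter; allFin)
open import Data.Product using (Σ; _×_; _,_; proj₁; proj₂)
open import Data.Rational using (0ℚ) renaming (_/_ to _/ℚ_)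
import Data.Rational.Properties as ℚP
open import Data.Sum using (inj₁; inj₂)
open import Function using (_∘_; Equivalence)
open import Relation.Binary.Definitions using (tri<; tri≈; tri>)
open import Relation.Binary.PropositionalEquality
open import Relation.Nullary using (yes; no; ¬_; contradiction)
open import Relation.Nullary.Decidable using (⌊_⌋; ⌊⌋-map′)
open import Algebra.Properties.Semiring.Sum ℤP.+-*-semiring
  using (sum-syntax; sum-cong-≗; sum-replicate-zero; ∑-comm; *-distribˡ-sum; *-distribʳ-sum)

open ≡-Reasoning

ind-∧ : ∀ x y → ind (x ∧ y) ≡ ind x * ind y
ind-∧ true  y = sym (ℤP.*-identityˡ (ind y))
ind-∧ false y = refl

ind-T : ∀ {b} → T b → ind b ≡ 1ℤ
ind-T {true} _ = refl

≮∧≯⇒≡ : ∀ {n} {a c : Fin n} → ¬ a < c → ¬ c < a → a ≡ c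
≮∧≯⇒≡ {a = a} {c} a≮c c≮a with <-cmp a c
... | tri< a<c _ _ = contradiction a<c a≮c
... | tri≈ _ a≡c _ = a≡c
... | tri> _ _ c<a = contradiction c<a c≮a

<ᵇ-connex : ∀ {n} {a c : Fin n} → a ≢ c → ind (a <ᵇ c) + ind (c <ᵇ a) ≡ 1ℤ
<ᵇ-connex {a = a} {c} a≢c with a <? c | c <? a
... | yes a<c | yes c<a = contradiction c<a (<-asym a<c)
... | yes _   | no _    = refl
... | no _    | yes _   = refl
... | no a≮c  | no c≮a  = contradiction (≮∧≯⇒≡ a≮c c≮a) a≢c

==-sym : ∀ {n} (i j : Fin n) → (i == j) ≡ (j == i)
==-sym i j with i ≟F j | j ≟F i
... | yes _    | yes _    = refl
... | yes refl | no j≢i   = contradiction refl j≢i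
... | no i≢j   | yes refl = contradiction refl i≢j
... | no _     | no _     = refl

edgeV-sym : ∀ {n} (u v : Fin n) → edgeV u v ≡ edgeV v u
edgeV-sym u v with u <? v | v <? u
... | yes u<v | yes v<u = contradiction v<u (<-asym u<v)
... | yes _   | no _    = refl
... | no _    | yes _   = refl
... | no u≮v  | no v≮u  rewrite ≮∧≯⇒≡ u≮v v≮u = refl

∑-distrib-- : ∀ {n} (g h : Fin n → ℤ) → ∑[ i < n ] (g i - h i) ≡ ∑[ i < n ] g i - ∑[ i < n ] h i
∑-distrib-- {zero}  g h = refl
∑-distrib-- {suc n} g h = begin
  g zero - h zero + ∑[ i < n ] (g (suc i) - h (suc i))
    ≡⟨ cong (_+_ (g zero - h zero)) (∑-distrib-- (g ∘ suc) (h ∘ suc)) ⟩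
  g zero - h zero + (∑[ i < n ] g (suc i) - ∑[ i < n ] h (suc i))
    ≡⟨ regroup (g zero) (h zero) _ _ ⟩
  (g zero + ∑[ i < n ] g (suc i)) - (h zero + ∑[ i < n ] h (suc i)) ∎
  where
  regroup : ∀ a b c d → a - b + (c - d) ≡ (a + c) - (b + d)
  regroup = solve-∀

∑-δ : ∀ {n} (a : Fin n) (g : Fin n → ℤ) → ∑[ i < n ] (ind (a == i) * g i) ≡ g a
∑-δ {suc n} zero    g = begin
  1ℤ * g zero + ∑[ i < n ] 0ℤ ≡⟨ cong₂ _+_ (ℤP.*-identityˡ (g zero)) (sum-replicate-zero n) ⟩
  g zero + 0ℤ                 ≡⟨ ℤP.+-identityʳ (g zero) ⟩
  g zero                      ∎
∑-δ {suc n} (suc a) g = begin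
  0ℤ + ∑[ i < n ] (ind (suc a == suc i) * g (suc i))
    ≡⟨ ℤP.+-identityˡ _ ⟩
  ∑[ i < n ] (ind (suc a == suc i) * g (suc i))
    ≡⟨ sum-cong-≗ (λ i → cong (λ b → ind b * g (suc i)) (⌊⌋-map′ (cong suc) suc-injective (a ≟F i))) ⟩
  ∑[ i < n ] (ind (a == i) * g (suc i))
    ≡⟨ ∑-δ a (g ∘ suc) ⟩
  g (suc a) ∎

∑²-δ : ∀ {m n} (a : Fin m) (b : Fin n) (g : Fin m → Fin n → ℤ) →
  ∑[ i < m ] ∑[ j < n ] (ind ((a == i) ∧ (b == j)) * g i j) ≡ g a b
∑²-δ {m} {n} a b g = begin
  ∑[ i < m ] ∑[ j < n ] (ind ((a == i) ∧ (b == j)) * g i j)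
    ≡⟨ sum-cong-≗ (λ i → sum-cong-≗ (λ j → factor (a == i) (b == j) (g i j))) ⟩
  ∑[ i < m ] ∑[ j < n ] (ind (a == i) * (ind (b == j) * g i j))
    ≡⟨ sum-cong-≗ (λ i → sym (*-distribˡ-sum (ind (a == i)) (λ j → ind (b == j) * g i j))) ⟩
  ∑[ i < m ] (ind (a == i) * ∑[ j < n ] (ind (b == j) * g i j))
    ≡⟨ ∑-δ a _ ⟩
  ∑[ j < n ] (ind (b == j) * g a j)
    ≡⟨ ∑-δ b (g a) ⟩
  g a b ∎
  where
  factor : ∀ x y (k : ℤ) → ind (x ∧ y) * k ≡ ind x * (ind y * k)
  factor x y k = trans (cong (_* k) (ind-∧ x y)) (ℤP.*-assoc (ind x) (ind y) k)

∑²-δ-difference : ∀ {n} (u v w : Fin n) (Y : Fin n → Fin n → ℤ) →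
  ∑[ a < n ] ∑[ b < n ] ((ind ((u == a) ∧ (v == b)) - ind ((w == a) ∧ (v == b))) * Y a b) ≡ Y u v - Y w v
∑²-δ-difference {n} u v w Y = begin
  ∑[ a < n ] ∑[ b < n ] ((δ u a b - δ w a b) * Y a b)
    ≡⟨ sum-cong-≗ (λ a → trans (sum-cong-≗ (λ b → distribʳ (δ u a b) (δ w a b) (Y a b)))
                               (∑-distrib-- (D u a) (D w a))) ⟩
  ∑[ a < n ] (∑[ b < n ] D u a b - ∑[ b < n ] D w a b)
    ≡⟨ ∑-distrib-- (λ a → ∑[ b < n ] D u a b) (λ a → ∑[ b < n ] D w a b) ⟩
  ∑[ a < n ] ∑[ b < n ] D u a b - ∑[ a < n ] ∑[ b < n ] D w a b
    ≡⟨ cong₂ _-_ (∑²-δ u v Y) (∑²-δ w v Y) ⟩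
  Y u v - Y w v ∎
  where
  δ D : Fin n → Fin n → Fin n → ℤ
  δ s a b = ind ((s == a) ∧ (v == b))
  D s a b = δ s a b * Y a b
  distribʳ : ∀ p q y → (p - q) * y ≡ p * y - q * y
  distribʳ = solve-∀

∑³-δ-difference : ∀ {n} (a b : Fin n) (X : Fin n → Fin n → Fin n → ℤ) →
  ∑[ u < n ] ∑[ v < n ] ∑[ w < n ] ((ind ((u == a) ∧ (v == b)) - ind ((w == a) ∧ (v == b))) * X u v w)
    ≡ ∑[ c < n ] (X a b c - X c b a)
∑³-δ-difference {n} a b X = begin
  ∑[ u < n ] ∑[ v < n ] ∑[ w < n ] ((δ u v - δ w v) * X u v w)
    ≡⟨ sum-cong-≗ (λ u → trans (sum-cong-≗ (λ v → trans (sum-cong-≗ (λ w → distribʳ (δ u v) (δ w v) (X u v w)))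
                                                          (∑-distrib-- (L u v) (R u v))))
                               (∑-distrib-- (λ v → ∑[ w < n ] L u v w) (λ v → ∑[ w < n ] R u v w))) ⟩
  ∑[ u < n ] (∑[ v < n ] ∑[ w < n ] L u v w - ∑[ v < n ] ∑[ w < n ] R u v w)
    ≡⟨ ∑-distrib-- (λ u → ∑[ v < n ] ∑[ w < n ] L u v w) (λ u → ∑[ v < n ] ∑[ w < n ] R u v w) ⟩
  ∑[ u < n ] ∑[ v < n ] ∑[ w < n ] L u v w - ∑[ u < n ] ∑[ v < n ] ∑[ w < n ] R u v w
    ≡⟨ cong₂ _-_ first second ⟩
  ∑[ c < n ] X a b c - ∑[ c < n ] X c b a
    ≡⟨ sym (∑-distrib-- (X a b) (λ c → X c b a)) ⟩
  ∑[ c < n ] (X a b c - X c b a) ∎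
  where
  δ : Fin n → Fin n → ℤ
  δ s v = ind ((s == a) ∧ (v == b))
  L R : Fin n → Fin n → Fin n → ℤ
  L u v w = δ u v * X u v w
  R u v w = δ w v * X u v w
  δ-flip : ∀ s v (y : ℤ) → δ s v * y ≡ ind ((a == s) ∧ (b == v)) * y
  δ-flip s v y = cong₂ (λ p q → ind (p ∧ q) * y) (==-sym s a) (==-sym v b)
  distribʳ : ∀ p q y → (p - q) * y ≡ p * y - q * y
  distribʳ = solve-∀
  first : ∑[ u < n ] ∑[ v < n ] ∑[ w < n ] L u v w ≡ ∑[ c < n ] X a b c
  first = trans (sum-cong-≗ (λ u → sum-cong-≗ (λ v → trans (sym (*-distribˡ-sum (δ u v) (X u v))) (δ-flip u v _))))
                (∑²-δ a b (λ u v → ∑[ w < n ] X u v w))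
  second : ∑[ u < n ] ∑[ v < n ] ∑[ w < n ] R u v w ≡ ∑[ c < n ] X c b a
  second = sum-cong-≗ (λ u → trans (∑-comm (λ v w → δ w v * X u v w))
                                   (trans (sum-cong-≗ (λ w → sum-cong-≗ (λ v → δ-flip w v (X u v w))))
                                          (∑²-δ a b (λ w v → X u v w))))

sumL-cong : ∀ {A : Set} (xs : List A) {g h : A → ℤ} → (∀ a → g a ≡ h a) → sumL xs g ≡ sumL xs h
sumL-cong []       eq = refl
sumL-cong (x ∷ xs) eq = cong₂ _+_ (eq x) (sumL-cong xs eq)

sumL≡∑ : ∀ {A : Set} (xs : List A) (g : A → ℤ) → sumL xs g ≡ ∑[ i < length xs ] g (lookup xs i)
sumL≡∑ []       g = refl
sumL≡∑ (x ∷ xs) g = cong (_+_ (g x)) (sumL≡∑ xs g)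

sumL-distrib-- : ∀ {A : Set} (xs : List A) (g h : A → ℤ) → sumL xs (λ a → g a - h a) ≡ sumL xs g - sumL xs h
sumL-distrib-- xs g h = begin
  sumL xs (λ a → g a - h a)
    ≡⟨ sumL≡∑ xs (λ a → g a - h a) ⟩
  ∑[ i < length xs ] (g (lookup xs i) - h (lookup xs i))
    ≡⟨ ∑-distrib-- (g ∘ lookup xs) (h ∘ lookup xs) ⟩
  ∑[ i < length xs ] g (lookup xs i) - ∑[ i < length xs ] h (lookup xs i)
    ≡⟨ sym (cong₂ _-_ (sumL≡∑ xs g) (sumL≡∑ xs h)) ⟩
  sumL xs g - sumL xs h ∎

sumL-*ˡ : ∀ {A : Set} (xs : List A) (c : ℤ) (g : A → ℤ) → sumL xs (λ a → c * g a) ≡ c * sumL xs g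
sumL-*ˡ xs c g = begin
  sumL xs (λ a → c * g a)                  ≡⟨ sumL≡∑ xs (λ a → c * g a) ⟩
  ∑[ i < length xs ] (c * g (lookup xs i))  ≡⟨ sym (*-distribˡ-sum c (g ∘ lookup xs)) ⟩
  c * ∑[ i < length xs ] g (lookup xs i)    ≡⟨ cong (c *_) (sym (sumL≡∑ xs g)) ⟩
  c * sumL xs g                            ∎

sumL-*ʳ : ∀ {A : Set} (xs : List A) (c : ℤ) (g : A → ℤ) → sumL xs g * c ≡ sumL xs (λ a → g a * c)
sumL-*ʳ xs c g = begin
  sumL xs g * c            ≡⟨ ℤP.*-comm (sumL xs g) c ⟩
  c * sumL xs g            ≡⟨ sym (sumL-*ˡ xs c g) ⟩
  sumL xs (λ a → c * g a)  ≡⟨ sumL-cong xs (λ a → ℤP.*-comm c (g a)) ⟩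
  sumL xs (λ a → g a * c)  ∎

sumL-comm : ∀ {A B : Set} (xs : List A) (ys : List B) (F : A → B → ℤ) →
  sumL xs (λ a → sumL ys (F a)) ≡ sumL ys (λ b → sumL xs (λ a → F a b))
sumL-comm xs ys F = begin
  sumL xs (λ a → sumL ys (F a))
    ≡⟨ trans (sumL≡∑ xs (λ a → sumL ys (F a))) (sum-cong-≗ (λ i → sumL≡∑ ys (F (lookup xs i)))) ⟩
  ∑[ i < length xs ] ∑[ j < length ys ] F (lookup xs i) (lookup ys j)
    ≡⟨ ∑-comm (λ i j → F (lookup xs i) (lookup ys j)) ⟩
  ∑[ j < length ys ] ∑[ i < length xs ] F (lookup xs i) (lookup ys j)
    ≡⟨ sym (trans (sumL≡∑ ys (λ b → sumL xs (λ a → F a b))) (sum-cong-≗ (λ j → sumL≡∑ xs (λ a → F a (lookup ys j))))) ⟩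
  sumL ys (λ b → sumL xs (λ a → F a b)) ∎

sumL-++ : ∀ {A : Set} (xs ys : List A) (g : A → ℤ) → sumL (xs ++ ys) g ≡ sumL xs g + sumL ys g
sumL-++ []       ys g = sym (ℤP.+-identityˡ _)
sumL-++ (x ∷ xs) ys g = trans (cong (_+_ (g x)) (sumL-++ xs ys g)) (sym (ℤP.+-assoc (g x) _ _))

sumL-concatMap : ∀ {A B : Set} (k : A → List B) (xs : List A) (g : B → ℤ) →
  sumL (concatMap k xs) g ≡ sumL xs (λ a → sumL (k a) g)
sumL-concatMap k []       g = refl
sumL-concatMap k (x ∷ xs) g =
  trans (sumL-++ (k x) (concatMap k xs) g) (cong (_+_ (sumL (k x) g)) (sumL-concatMap k xs g))

sumL-map : ∀ {A B : Set} (k : A → B) (xs : List A) (g : B → ℤ) → sumL (map k xs) g ≡ sumL xs (g ∘ k)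
sumL-map k []       g = refl
sumL-map k (x ∷ xs) g = cong (_+_ (g (k x))) (sumL-map k xs g)

sumL-tabulate : ∀ {A : Set} {n} (k : Fin n → A) (g : A → ℤ) → sumL (tabulate k) g ≡ ∑[ i < n ] g (k i)
sumL-tabulate {n = zero}  k g = refl
sumL-tabulate {n = suc n} k g = cong (_+_ (g (k zero))) (sumL-tabulate (k ∘ suc) g)

sumL-allFin : ∀ n (g : Fin n → ℤ) → sumL (allFin n) g ≡ ∑[ i < n ] g i
sumL-allFin n g = sumL-tabulate (λ i → i) g

sumL-pairs : ∀ n (h : Fin n × Fin n → ℤ) → sumL (pairs n) h ≡ ∑[ u < n ] ∑[ v < n ] h (u , v)
sumL-pairs n h = begin
  sumL (pairs n) h
    ≡⟨ sumL-concatMap (λ u → map (u ,_) (allFin n)) (allFin n) h ⟩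
  sumL (allFin n) (λ u → sumL (map (u ,_) (allFin n)) h)
    ≡⟨ sumL-allFin n _ ⟩
  ∑[ u < n ] sumL (map (u ,_) (allFin n)) h
    ≡⟨ sum-cong-≗ (λ u → trans (sumL-map (u ,_) (allFin n) h) (sumL-allFin n _)) ⟩
  ∑[ u < n ] ∑[ v < n ] h (u , v) ∎

sumL-triples : ∀ n (h : Fin n × Fin n × Fin n → ℤ) →
  sumL (triples n) h ≡ ∑[ u < n ] ∑[ v < n ] ∑[ w < n ] h (u , v , w)
sumL-triples n h = begin
  sumL (triples n) h
    ≡⟨ sumL-concatMap (λ u → map (u ,_) (pairs n)) (allFin n) h ⟩
  sumL (allFin n) (λ u → sumL (map (u ,_) (pairs n)) h)
    ≡⟨ sumL-allFin n _ ⟩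
  ∑[ u < n ] sumL (map (u ,_) (pairs n)) h
    ≡⟨ sum-cong-≗ (λ u → trans (sumL-map (u ,_) (pairs n) h) (sumL-pairs n (h ∘ (u ,_)))) ⟩
  ∑[ u < n ] ∑[ v < n ] ∑[ w < n ] h (u , v , w) ∎

length-filter : ∀ {A : Set} (P : A → Bool) (xs : List A) →
  + length (filter (T? ∘ P) xs) ≡ sumL xs (ind ∘ P)
length-filter P []       = refl
length-filter P (x ∷ xs) with P x
... | true  = trans (ℤP.pos-+ 1 _) (cong (_+_ 1ℤ) (length-filter P xs))
... | false = trans (length-filter P xs) (sym (ℤP.+-identityˡ _))

zeroExtend : ∀ {A : Set} (P : A → Bool) → (Σ A (T ∘ P) → ℤ) → A → ℤ
zeroExtend P g a with T? (P a)
... | yes p = g (a , p)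
... | no _  = 0ℤ

sumL-collect : ∀ {A : Set} (P : A → Bool) (xs : List A) (g : Σ A (T ∘ P) → ℤ) →
  sumL (collect P xs) g ≡ sumL xs (zeroExtend P g)
sumL-collect P []       g = refl
sumL-collect P (a ∷ as) g with T? (P a)
... | yes p = cong (_+_ (g (a , p))) (sumL-collect P as g)
... | no _  = trans (sumL-collect P as g) (sym (ℤP.+-identityˡ _))

zeroExtend-at : ∀ {A : Set} (P : A → Bool) (g : Σ A (T ∘ P) → ℤ) {a : A} (p : T (P a)) →
  zeroExtend P g a ≡ g (a , p)
zeroExtend-at P g {a} p with T? (P a)
... | yes p′ = cong (λ q → g (a , q)) (T-irrelevant p′ p)
... | no ¬p  = contradiction p ¬p

zeroExtend-lift : ∀ {A : Set} (P : A → Bool) {g : Σ A (T ∘ P) → ℤ} (h : A → ℤ) →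
  (∀ s → g s ≡ h (proj₁ s)) → ∀ a → zeroExtend P g a ≡ ind (P a) * h a
zeroExtend-lift P h eq a with T? (P a)
... | yes p = trans (eq (a , p)) (sym (trans (cong (_* h a) (ind-T p)) (ℤP.*-identityˡ (h a))))
... | no ¬p = sym (cong (_* h a) (¬T⇒ind≡0 (P a) ¬p))
  where
  ¬T⇒ind≡0 : ∀ b → ¬ T b → ind b ≡ 0ℤ
  ¬T⇒ind≡0 true  ¬t = contradiction _ ¬t
  ¬T⇒ind≡0 false _  = refl

zeroExtend-*ˡ : ∀ {A : Set} (P : A → Bool) (k : A → ℤ) (g : Σ A (T ∘ P) → ℤ) a →
  zeroExtend P (λ s → k (proj₁ s) * g s) a ≡ k a * zeroExtend P g a
zeroExtend-*ˡ P k g a with T? (P a)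
... | yes _ = refl
... | no _  = sym (ℤP.*-zeroʳ (k a))

module _ (H : OrGraph) where

  inner : Chain H → Chain H → ℤ
  inner x y = sumL (edges H) (λ e → x e * y e)

  -- boundary H x v is by definition inner x (incidence v).
  incidence : Vtx H → Chain H
  incidence v e = ind ⌊ (_≟V_ H) (tgt H e) v ⌋ - ind ⌊ (_≟V_ H) (src H e) v ⌋

  inner-comm : ∀ x y → inner x y ≡ inner y x
  inner-comm x y = sumL-cong (edges H) (λ e → ℤP.*-comm (x e) (y e))

  inner-subˡ : ∀ x y z → inner (λ e → x e - y e) z ≡ inner x z - inner y z
  inner-subˡ x y z = trans (sumL-cong (edges H) (λ e → distribʳ (x e) (y e) (z e)))
                           (sumL-distrib-- (edges H) (λ e → x e * z e) (λ e → y e * z e))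
    where
    distribʳ : ∀ a b c → (a - b) * c ≡ a * c - b * c
    distribʳ = solve-∀

  inner-scaleˡ : ∀ c x y → inner (λ e → c * x e) y ≡ c * inner x y
  inner-scaleˡ c x y = trans (sumL-cong (edges H) (λ e → ℤP.*-assoc c (x e) (y e))) (sumL-*ˡ (edges H) c (λ e → x e * y e))

  inner-zeroˡ : ∀ y → inner (λ _ → 0ℤ) y ≡ 0ℤ
  inner-zeroˡ = sumL-*ˡ (edges H) 0ℤ

  selfAdjoint-scaling-incidence⇒flow : (T : Chain H → Chain H) (d : ℕ) →
    (∀ x y → inner (T x) y ≡ inner x (T y)) →
    (∀ v e → T (incidence v) e ≡ + d * incidence v e) →
    ∀ x → IsFlow H (λ e → T x e - + d * x e)
  selfAdjoint-scaling-incidence⇒flow T d selfAdj scales x v = begin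
    inner (λ e → T x e - + d * x e) ι
      ≡⟨ inner-subˡ (T x) _ ι ⟩
    inner (T x) ι - inner (λ e → + d * x e) ι
      ≡⟨ cong₂ _-_ (selfAdj x ι) (inner-scaleˡ (+ d) x ι) ⟩
    inner x (T ι) - + d * inner x ι
      ≡⟨ cong (_- + d * inner x ι) (trans (sumL-cong (edges H) (λ e → cong (x e *_) (scales v e))) (inner-comm x _)) ⟩
    inner (λ e → + d * ι e) x - + d * inner x ι
      ≡⟨ cong (_- + d * inner x ι) (trans (inner-scaleˡ (+ d) ι x) (cong (+ d *_) (inner-comm ι x))) ⟩
    + d * inner x ι - + d * inner x ι
      ≡⟨ ℤP.+-inverseʳ (+ d * inner x ι) ⟩
    0ℤ ∎
    where
    ι = incidence v

  flow⇒CritEq : ∀ {x y} → IsFlow H (λ e → x e - y e) → CritEq H x y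
  flow⇒CritEq {x} {y} flow =
    (λ _ → 0ℤ) , (λ e → x e - y e) , ((λ _ → 0ℚ) , λ _ → refl) , flow , λ e → sym (ℤP.+-identityˡ _)

  cut⇒CritEq : ∀ {x y} → IsCut H (λ e → x e - y e) → CritEq H x y
  cut⇒CritEq {x} {y} cut =
    (λ e → x e - y e) , (λ _ → 0ℤ) , cut , (λ v → inner-zeroˡ (incidence v)) , λ e → sym (ℤP.+-identityʳ _)

linMap-adjoint : (H₁ H₂ : OrGraph) (M : Edge H₁ → Edge H₂ → ℤ) (x : Chain H₁) (z : Chain H₂) →
  inner H₂ (linMap H₁ H₂ M x) z ≡ inner H₁ x (linMapᵗ H₁ H₂ M z)
linMap-adjoint H₁ H₂ M x z = begin
  sumL E₂ (λ e₂ → sumL E₁ (λ e₁ → x e₁ * M e₁ e₂) * z e₂)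
    ≡⟨ sumL-cong E₂ (λ e₂ → trans (sumL-*ʳ E₁ (z e₂) (λ e₁ → x e₁ * M e₁ e₂))
                                  (sumL-cong E₁ (λ e₁ → ℤP.*-assoc (x e₁) (M e₁ e₂) (z e₂)))) ⟩
  sumL E₂ (λ e₂ → sumL E₁ (λ e₁ → x e₁ * (M e₁ e₂ * z e₂)))
    ≡⟨ sumL-comm E₂ E₁ (λ e₂ e₁ → x e₁ * (M e₁ e₂ * z e₂)) ⟩
  sumL E₁ (λ e₁ → sumL E₂ (λ e₂ → x e₁ * (M e₁ e₂ * z e₂)))
    ≡⟨ sumL-cong E₁ (λ e₁ → sumL-*ˡ E₂ (x e₁) (λ e₂ → M e₁ e₂ * z e₂)) ⟩
  sumL E₁ (λ e₁ → x e₁ * sumL E₂ (λ e₂ → M e₁ e₂ * z e₂)) ∎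
  where
  E₁ = edges H₁
  E₂ = edges H₂

module _ {n : ℕ} (G : SimpleGraph n) where

  isSdEdge : Fin n × Fin n → Bool
  isSdEdge p = adj G (proj₁ p) (proj₂ p)

  sdValue : Chain (sdG G) → Fin n → Fin n → ℤ
  sdValue z a b = zeroExtend isSdEdge z (a , b)

  lineValue : Chain (lineG G) → Fin n → Fin n → Fin n → ℤ
  lineValue x u v w = zeroExtend (isLineEdge G) x (u , v , w)

  ∑-adj≡degree : ∀ {d} → Regular G d → ∀ b → ∑[ c < n ] ind (adj G b c) ≡ + d
  ∑-adj≡degree {d} regular b = begin
    ∑[ c < n ] ind (adj G b c)      ≡⟨ sym (sumL-allFin n (ind ∘ adj G b)) ⟩
    sumL (allFin n) (ind ∘ adj G b) ≡⟨ sym (length-filter (adj G b) (allFin n)) ⟩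
    + degree G b                    ≡⟨ cong +_ (regular b) ⟩
    + d                             ∎

  fᵗ-apply : ∀ z u v w q → fᵗ G z ((u , v , w) , q) ≡ sdValue z u v - sdValue z w v
  fᵗ-apply z u v w q = begin
    sumL (collect isSdEdge (pairs n)) (λ e → m (proj₁ e) * z e)
      ≡⟨ sumL-collect isSdEdge (pairs n) _ ⟩
    sumL (pairs n) (zeroExtend isSdEdge (λ e → m (proj₁ e) * z e))
      ≡⟨ sumL-cong (pairs n) (zeroExtend-*ˡ isSdEdge m z) ⟩
    sumL (pairs n) (λ p → m p * zeroExtend isSdEdge z p)
      ≡⟨ sumL-pairs n _ ⟩
    ∑[ a < n ] ∑[ b < n ] (m (a , b) * sdValue z a b)
      ≡⟨ ∑²-δ-difference u v w (sdValue z) ⟩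
    sdValue z u v - sdValue z w v ∎
    where
    m : Fin n × Fin n → ℤ
    m p = ind ((u == proj₁ p) ∧ (v == proj₂ p)) - ind ((w == proj₁ p) ∧ (v == proj₂ p))

  -- The line edge {ab, bc} is listed once, as (a,b,c) or (c,b,a) according to the order of
  -- a and c, so at most one of the two terms is nonzero.
  f-apply : ∀ x a b p → f G x ((a , b) , p) ≡ ∑[ c < n ] (lineValue x a b c - lineValue x c b a)
  f-apply x a b p = begin
    sumL (collect (isLineEdge G) (triples n)) (λ e → x e * m (proj₁ e))
      ≡⟨ sumL-cong (collect (isLineEdge G) (triples n)) (λ e → ℤP.*-comm (x e) (m (proj₁ e))) ⟩
    sumL (collect (isLineEdge G) (triples n)) (λ e → m (proj₁ e) * x e)
      ≡⟨ sumL-collect (isLineEdge G) (triples n) _ ⟩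
    sumL (triples n) (zeroExtend (isLineEdge G) (λ e → m (proj₁ e) * x e))
      ≡⟨ sumL-cong (triples n) (zeroExtend-*ˡ (isLineEdge G) m x) ⟩
    sumL (triples n) (λ t → m t * zeroExtend (isLineEdge G) x t)
      ≡⟨ sumL-triples n _ ⟩
    ∑[ u < n ] ∑[ v < n ] ∑[ w < n ] (m (u , v , w) * lineValue x u v w)
      ≡⟨ ∑³-δ-difference a b (lineValue x) ⟩
    ∑[ c < n ] (lineValue x a b c - lineValue x c b a) ∎
    where
    m : Fin n × Fin n × Fin n → ℤ
    m t = ind ((proj₁ t == a) ∧ (proj₁ (proj₂ t) == b)) - ind ((proj₂ (proj₂ t) == a) ∧ (proj₁ (proj₂ t) == b))

  ind-isLineEdge : ∀ u v w → ind (isLineEdge G (u , v , w)) ≡ ind (adj G u v) * (ind (adj G v w) * ind (u <ᵇ w))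
  ind-isLineEdge u v w = trans (ind-∧ (adj G u v) _) (cong (ind (adj G u v) *_) (ind-∧ (adj G v w) (u <ᵇ w)))

  oriented-lineEdge : (ψ : Fin n → Fin n → ℤ) {a b : Fin n} → T (adj G a b) → ∀ c →
    ind (isLineEdge G (a , b , c)) * (ψ b c - ψ b a) - ind (isLineEdge G (c , b , a)) * (ψ b a - ψ b c)
      ≡ ind (adj G b c) * (ψ b c - ψ b a)
  oriented-lineEdge ψ {a} {b} p c with a ≟F c
  ... | yes refl = degenerate (ind (isLineEdge G (a , b , a))) (ind (adj G b a)) (ψ b a)
    where
    degenerate : ∀ l k y → l * (y - y) - l * (y - y) ≡ k * (y - y)
    degenerate = solve-∀
  ... | no a≢c = begin
    ind (isLineEdge G (a , b , c)) * δ - ind (isLineEdge G (c , b , a)) * (ψ b a - ψ b c)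
      ≡⟨ cong₂ (λ l l′ → l * δ - l′ * (ψ b a - ψ b c)) (ind-isLineEdge a b c) (ind-isLineEdge c b a) ⟩
    ind (adj G a b) * (ind (adj G b c) * lt) * δ - ind (adj G c b) * (ind (adj G b a) * gt) * (ψ b a - ψ b c)
      ≡⟨ cong₂ _-_ (cong (λ i → i * (ind (adj G b c) * lt) * δ) (ind-T p))
                   (cong₂ (λ j k → j * (k * gt) * (ψ b a - ψ b c))
                          (cong ind (adj-sym G c b)) (trans (cong ind (adj-sym G b a)) (ind-T p))) ⟩
    1ℤ * (ind (adj G b c) * lt) * δ - ind (adj G b c) * (1ℤ * gt) * (ψ b a - ψ b c)
      ≡⟨ regroup (ind (adj G b c)) lt gt (ψ b c) (ψ b a) ⟩
    ind (adj G b c) * ((lt + gt) * δ)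
      ≡⟨ cong (λ s → ind (adj G b c) * (s * δ)) (<ᵇ-connex a≢c) ⟩
    ind (adj G b c) * (1ℤ * δ)
      ≡⟨ cong (ind (adj G b c) *_) (ℤP.*-identityˡ δ) ⟩
    ind (adj G b c) * δ ∎
    where
    δ = ψ b c - ψ b a
    lt = ind (a <ᵇ c)
    gt = ind (c <ᵇ a)
    regroup : ∀ k l g y y′ → 1ℤ * (k * l) * (y - y′) - k * (1ℤ * g) * (y′ - y) ≡ k * ((l + g) * (y - y′))
    regroup = solve-∀

  f-coboundary : ∀ {d} → Regular G d → (ψ : Fin n → Fin n → ℤ) (x : Chain (lineG G)) →
    (∀ u v w q → x ((u , v , w) , q) ≡ ψ v w - ψ v u) →
    ∀ a b p → f G x ((a , b) , p) ≡ ∑[ c < n ] (ind (adj G b c) * ψ b c) - + d * ψ b a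
  f-coboundary {d} regular ψ x x≡dψ a b p = begin
    f G x ((a , b) , p)
      ≡⟨ f-apply x a b p ⟩
    ∑[ c < n ] (lineValue x a b c - lineValue x c b a)
      ≡⟨ sum-cong-≗ (λ c → cong₂ _-_ (lift (a , b , c)) (lift (c , b , a))) ⟩
    ∑[ c < n ] (ind (isLineEdge G (a , b , c)) * (ψ b c - ψ b a) - ind (isLineEdge G (c , b , a)) * (ψ b a - ψ b c))
      ≡⟨ sum-cong-≗ (oriented-lineEdge ψ p) ⟩
    ∑[ c < n ] (ind (adj G b c) * (ψ b c - ψ b a))
      ≡⟨ sum-cong-≗ (λ c → distribˡ (ind (adj G b c)) (ψ b c) (ψ b a)) ⟩
    ∑[ c < n ] (ind (adj G b c) * ψ b c - ind (adj G b c) * ψ b a)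
      ≡⟨ ∑-distrib-- (λ c → ind (adj G b c) * ψ b c) (λ c → ind (adj G b c) * ψ b a) ⟩
    ∑[ c < n ] (ind (adj G b c) * ψ b c) - ∑[ c < n ] (ind (adj G b c) * ψ b a)
      ≡⟨ cong (_-_ (∑[ c < n ] (ind (adj G b c) * ψ b c)))
              (trans (sym (*-distribʳ-sum (ψ b a) (ind ∘ adj G b))) (cong (_* ψ b a) (∑-adj≡degree regular b))) ⟩
    ∑[ c < n ] (ind (adj G b c) * ψ b c) - + d * ψ b a ∎
    where
    distribˡ : ∀ k y y′ → k * (y - y′) ≡ k * y - k * y′
    distribˡ = solve-∀
    lift : ∀ t → lineValue x (proj₁ t) (proj₁ (proj₂ t)) (proj₂ (proj₂ t))
               ≡ ind (isLineEdge G t) * (ψ (proj₁ (proj₂ t)) (proj₂ (proj₂ t)) - ψ (proj₁ (proj₂ t)) (proj₁ t))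
    lift = zeroExtend-lift (isLineEdge G) (λ { (u , v , w) → ψ v w - ψ v u }) (λ { ((u , v , w) , q) → x≡dψ u v w q })

  fᵗf-selfAdjoint : ∀ x y → inner (lineG G) (fᵗ G (f G x)) y ≡ inner (lineG G) x (fᵗ G (f G y))
  fᵗf-selfAdjoint x y = begin
    inner (lineG G) (fᵗ G (f G x)) y  ≡⟨ inner-comm (lineG G) _ y ⟩
    inner (lineG G) y (fᵗ G (f G x))  ≡⟨ sym (linMap-adjoint (lineG G) (sdG G) (fMatrix G) y (f G x)) ⟩
    inner (sdG G) (f G y) (f G x)     ≡⟨ inner-comm (sdG G) (f G y) (f G x) ⟩
    inner (sdG G) (f G x) (f G y)     ≡⟨ linMap-adjoint (lineG G) (sdG G) (fMatrix G) x (f G y) ⟩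
    inner (lineG G) x (fᵗ G (f G y))  ∎

  lineEdge-adj : ∀ {u v w} → T (isLineEdge G (u , v , w)) → T (adj G u v) × T (adj G w v)
  lineEdge-adj {u} {v} {w} q with Equivalence.to T-∧ q
  ... | uv , rest = uv , subst T (adj-sym G v w) (proj₁ (Equivalence.to T-∧ rest))

  fᵗf-incidence : ∀ {d} → Regular G d → ∀ t e →
    fᵗ G (f G (incidence (lineG G) t)) e ≡ + d * incidence (lineG G) t e
  fᵗf-incidence {d} regular t ((u , v , w) , q) = begin
    fᵗ G y ((u , v , w) , q)
      ≡⟨ fᵗ-apply y u v w q ⟩
    sdValue y u v - sdValue y w v
      ≡⟨ cong₂ _-_ (zeroExtend-at isSdEdge y uv) (zeroExtend-at isSdEdge y wv) ⟩
    y ((u , v) , uv) - y ((w , v) , wv)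
      ≡⟨ cong₂ _-_ (f-coboundary regular ψ ι ι≡dψ u v uv) (f-coboundary regular ψ ι ι≡dψ w v wv) ⟩
    (N - + d * ψ v u) - (N - + d * ψ v w)
      ≡⟨ cancel N (+ d) (ψ v u) (ψ v w) ⟩
    + d * (ψ v w - ψ v u)
      ≡⟨ cong (+ d *_) (sym (ι≡dψ u v w q)) ⟩
    + d * ι ((u , v , w) , q) ∎
    where
    ι = incidence (lineG G) t
    y = f G ι
    ψ : Fin n → Fin n → ℤ
    ψ v w = ind ⌊ decPair (edgeV v w) t ⌋
    ι≡dψ : ∀ u v w q → ι ((u , v , w) , q) ≡ ψ v w - ψ v u
    ι≡dψ u v w q = cong (λ s → ψ v w - ind ⌊ decPair s t ⌋) (edgeV-sym u v)
    N = ∑[ c < n ] (ind (adj G v c) * ψ v c)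
    uv = proj₁ (lineEdge-adj q)
    wv = proj₂ (lineEdge-adj q)
    cancel : ∀ s k y y′ → (s - k * y) - (s - k * y′) ≡ k * (y′ - y)
    cancel = solve-∀

  ffᵗ-minus-scale : ∀ {d} → Regular G d → ∀ z a b p →
    f G (fᵗ G z) ((a , b) , p) - + d * z ((a , b) , p) ≡ ∑[ c < n ] (ind (adj G b c) * - sdValue z c b)
  ffᵗ-minus-scale {d} regular z a b p = begin
    f G (fᵗ G z) ((a , b) , p) - + d * z ((a , b) , p)
      ≡⟨ cong₂ (λ s y → s - + d * y) (f-coboundary regular ψ (fᵗ G z) fᵗz≡dψ a b p) (sym (zeroExtend-at isSdEdge z p)) ⟩
    (S - + d * - sdValue z a b) - + d * sdValue z a b
      ≡⟨ cancel S (+ d) (sdValue z a b) ⟩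
    S ∎
    where
    ψ : Fin n → Fin n → ℤ
    ψ v w = - sdValue z w v
    S = ∑[ c < n ] (ind (adj G b c) * ψ b c)
    fᵗz≡dψ : ∀ u v w q → fᵗ G z ((u , v , w) , q) ≡ ψ v w - ψ v u
    fᵗz≡dψ u v w q = trans (fᵗ-apply z u v w q) (flip (sdValue z u v) (sdValue z w v))
      where
      flip : ∀ y y′ → y - y′ ≡ - y′ - - y
      flip = solve-∀
    cancel : ∀ s k y → (s - k * - y) - k * y ≡ s
    cancel = solve-∀

  targetPotential⇒cut : (Φ : Fin n → ℤ) (x : Chain (sdG G)) → (∀ a b p → x ((a , b) , p) ≡ Φ b) → IsCut (sdG G) x
  targetPotential⇒cut Φ x x≡Φ =
    (λ { (inj₁ b) → Φ b /ℚ 1 ; (inj₂ _) → 0ℚ }) ,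
    λ { ((a , b) , p) → trans (cong (_/ℚ 1) (x≡Φ a b p)) (sym (ℚP.+-identityʳ (Φ b /ℚ 1))) }

proposition6p5 : ∀ {n} (G : SimpleGraph n) (d : ℕ) → Regular G d → Connected G →
    ((x : Chain (lineG G)) → CritEq (lineG G) (fᵗ G (f G x)) (scale {lineG G} d x))
    × ((z : Chain (sdG G)) → CritEq (sdG G) (f G (fᵗ G z)) (scale {sdG G} d z))
proposition6p5 G d regular _ =
  (λ x → flow⇒CritEq (lineG G) {fᵗ G (f G x)} {scale {lineG G} d x}
           (selfAdjoint-scaling-incidence⇒flow (lineG G) (fᵗ G ∘ f G) d (fᵗf-selfAdjoint G) (fᵗf-incidence G regular) x)) ,
  (λ z → cut⇒CritEq (sdG G) {f G (fᵗ G z)} {scale {sdG G} d z}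
           (targetPotential⇒cut G _ (λ e → f G (fᵗ G z) e - + d * z e) (ffᵗ-minus-scale G regular z)))
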